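{- Let $t\geq 1$, $\ell\geq 3$, $k\geq t+\ell-2$ be integers and let $\mathcal{F}\subset\binom{[n]}{k}$ be a family such that $\binom{\ell}{2}(t-1)+\binom{\ell-1}{2}\leq \sum_{1\leq i<j\leq \ell}|F_i\cap F_j|$ for every choice of $\ell$ distinct members $F_1,\dots,F_\ell$ of $\mathcal{F}$. Suppose $\mathcal{F}$ contains a sunflower with a kernel $T$ of size $t$ and $2k+\ell-2$ petals. Then every $F\in\mathcal{F}$ satisfies $|F\cap T|\geq t-1$.
   Context: $\binom{[n]}{k}$ denotes the family of all $k$-element subsets of $[n]=\{1,\dots,n\}$. A sunflower with kernel $T$ ($|T|=t$) and $u$ petals is a family of $u$ sets $T\cup P_1,\dots,T\cup P_u$ of size $k$, where $P_1,\dots,P_u$ (the petals) are pairwise disjoint and disjoint from $T$; so any two of its members intersect exactly in $T$. -}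

module Defs where

open import Data.Nat using (ℕ; zero; suc; _+_)
open import Data.Fin using (Fin; zero; suc)
open import Data.Fin.Subset using (Subset; _∪_; _∩_; ⊥; ∣_∣)
open import Relation.Binary.PropositionalEquality using (_≡_; _≢_)
open import Data.Product using (_×_)

sumFin : (m : ℕ) → (Fin m → ℕ) → ℕ
sumFin zero f = 0
sumFin (suc m) f = f zero + sumFin m (λ i → f (suc i))

pairSum : (m : ℕ) → (Fin m → Fin m → ℕ) → ℕ
pairSum zero f = 0
pairSum (suc m) f = sumFin m (λ j → f zero (suc j)) + pairSum m (λ i j → f (suc i) (suc j))

Family : ℕ → Set₁
Family n = Subset n → Set

Uniform : {n : ℕ} → ℕ → Family n → Set
Uniform k 𝓕 = ∀ A → 𝓕 A → ∣ A ∣ ≡ k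

IsSunflowerIn : {n : ℕ} → Family n → Subset n → (u : ℕ) → (Fin u → Subset n) → Set
IsSunflowerIn 𝓕 T u P =
  (∀ i j → i ≢ j → P i ∩ P j ≡ ⊥) ×
  (∀ i → P i ∩ T ≡ ⊥) ×
  (∀ i → 𝓕 (T ∪ P i))

-- F has k elements and the petals are pairwise disjoint, so at most k of the
-- 2k + ℓ − 2 petals meet F (k + ℓ − 1 petals would suffice). Take F together with
-- ℓ − 1 sunflower members whose petals miss F. These ℓ sets are distinct
-- (any two meet in at most t < k elements), F meets each of the others in F ∩ T,
-- and the others pairwise meet in T, so the hypothesis reads
--   C(ℓ,2)(t − 1) + C(ℓ−1,2) ≤ (ℓ − 1)|F ∩ T| + C(ℓ−1,2) t.
-- Since C(ℓ,2) = (ℓ − 1) + C(ℓ−1,2), this is (ℓ − 1)(t − 1) ≤ (ℓ − 1)|F ∩ T|.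
module Submission where

open import Defs
open import Data.Nat using (ℕ; zero; suc; _+_; _*_; _∸_; _≤_; _<_; z≤n; s≤s; NonZero)
open import Data.Nat.Properties
  using (≤-reflexive; ≤-trans; ≤-pred; <-irrefl; ≤-<-trans; <-≤-trans; m≤n+m; m<m+n;
         +-comm; +-assoc; +-suc; +-identityʳ; +-monoˡ-≤; +-monoʳ-≤; +-cancelʳ-≤; +-∸-assoc;
         *-distribʳ-+; *-cancelˡ-≤; module ≤-Reasoning)
open import Data.Nat.Combinatorics using (_C_; nCk+nC[k+1]≡[n+1]C[k+1]; nC1≡n)
open import Data.Nat.Tactic.RingSolver using (solve-∀)
open import Data.Bool using (true; false)
open import Data.Vec using ([]; _∷_)
open import Data.Vec.Functional using () renaming (_∷_ to _◂_)
open import Data.Fin using (Fin; zero; suc) renaming (_≟_ to _≟ᶠ_)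
open import Data.Fin.Properties using (suc-injective)
open import Data.Fin.Subset using (Subset; _∩_; _∪_; ∁; ⊥; ⊤; ∣_∣)
open import Data.Fin.Subset.Properties
  using (∩-comm; ∩-assoc; ∩-idem; ∩-identityʳ; ∩-distribˡ-∪;
         ∪-identityʳ; ∪-identityˡ; ∪-distribˡ-∩; p∪∁p≡⊤; ∣p∩q∣≤∣q∣)
open import Data.Product using (Σ-syntax; _×_; _,_; proj₁; proj₂)
open import Function using (_∘_)
open import Function.Definitions using (Injective)
open import Relation.Nullary using (yes; no; contradiction)
open import Relation.Binary.PropositionalEquality
  using (_≡_; _≢_; refl; sym; trans; cong; cong₂; subst; subst₂; module ≡-Reasoning)

sumFin-cong : ∀ m {f g : Fin m → ℕ} → (∀ i → f i ≡ g i) → sumFin m f ≡ sumFin m g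
sumFin-cong zero    f≗g = refl
sumFin-cong (suc m) f≗g = cong₂ _+_ (f≗g zero) (sumFin-cong m (f≗g ∘ suc))

PairwiseDisjoint : ∀ {n m} → (Fin m → Subset n) → Set
PairwiseDisjoint P = ∀ i j → i ≢ j → P i ∩ P j ≡ ⊥

∣p∩q∣+∣p∩∁q∣≡∣p∣ : ∀ {n} (p q : Subset n) → ∣ p ∩ q ∣ + ∣ p ∩ ∁ q ∣ ≡ ∣ p ∣
∣p∩q∣+∣p∩∁q∣≡∣p∣ []          []          = refl
∣p∩q∣+∣p∩∁q∣≡∣p∣ (false ∷ p) (_ ∷ q)     = ∣p∩q∣+∣p∩∁q∣≡∣p∣ p q
∣p∩q∣+∣p∩∁q∣≡∣p∣ (true ∷ p)  (true ∷ q)  = cong suc (∣p∩q∣+∣p∩∁q∣≡∣p∣ p q)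
∣p∩q∣+∣p∩∁q∣≡∣p∣ (true ∷ p)  (false ∷ q) =
  trans (+-suc ∣ p ∩ q ∣ _) (cong suc (∣p∩q∣+∣p∩∁q∣≡∣p∣ p q))

∣p∣≡0⇒p≡⊥ : ∀ {n} {p : Subset n} → ∣ p ∣ ≡ 0 → p ≡ ⊥
∣p∣≡0⇒p≡⊥ {p = []}        _ = refl
∣p∣≡0⇒p≡⊥ {p = false ∷ p} e = cong (false ∷_) (∣p∣≡0⇒p≡⊥ e)

q∩p≡⊥⇒q∩∁p≡q : ∀ {n} {p q : Subset n} → q ∩ p ≡ ⊥ → q ∩ ∁ p ≡ q
q∩p≡⊥⇒q∩∁p≡q {p = p} {q} q∩p≡⊥ = begin
  q ∩ ∁ p              ≡⟨ sym (∪-identityˡ (q ∩ ∁ p)) ⟩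
  ⊥ ∪ q ∩ ∁ p          ≡⟨ cong (_∪ q ∩ ∁ p) (sym q∩p≡⊥) ⟩
  q ∩ p ∪ q ∩ ∁ p      ≡⟨ sym (∩-distribˡ-∪ q p (∁ p)) ⟩
  q ∩ (p ∪ ∁ p)        ≡⟨ cong (q ∩_) (p∪∁p≡⊤ p) ⟩
  q ∩ ⊤                ≡⟨ ∩-identityʳ q ⟩
  q                    ∎
  where open ≡-Reasoning

p∩r≡p∩∁q∩r : ∀ {n} (p : Subset n) {q r : Subset n} → r ∩ q ≡ ⊥ → p ∩ r ≡ (p ∩ ∁ q) ∩ r
p∩r≡p∩∁q∩r p {q} {r} r∩q≡⊥ = begin
  p ∩ r            ≡⟨ cong (p ∩_) (sym (q∩p≡⊥⇒q∩∁p≡q r∩q≡⊥)) ⟩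
  p ∩ (r ∩ ∁ q)    ≡⟨ cong (p ∩_) (∩-comm r (∁ q)) ⟩
  p ∩ (∁ q ∩ r)    ≡⟨ sym (∩-assoc p (∁ q) r) ⟩
  (p ∩ ∁ q) ∩ r    ∎
  where open ≡-Reasoning

sum-∣∩∣≤∣∣ : ∀ {n} m (P : Fin m → Subset n) → PairwiseDisjoint P →
  ∀ F → sumFin m (λ i → ∣ F ∩ P i ∣) ≤ ∣ F ∣
sum-∣∩∣≤∣∣ zero    P disjoint F = z≤n
sum-∣∩∣≤∣∣ (suc m) P disjoint F = begin
  ∣ F ∩ P zero ∣ + sumFin m (λ i → ∣ F ∩ P (suc i) ∣)
    ≡⟨ cong (∣ F ∩ P zero ∣ +_) (sumFin-cong m (λ i → cong ∣_∣ (p∩r≡p∩∁q∩r F (disjoint (suc i) zero λ ())))) ⟩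
  ∣ F ∩ P zero ∣ + sumFin m (λ i → ∣ (F ∩ ∁ (P zero)) ∩ P (suc i) ∣)
    ≤⟨ +-monoʳ-≤ ∣ F ∩ P zero ∣ (sum-∣∩∣≤∣∣ m (P ∘ suc) disjoint-tail (F ∩ ∁ (P zero))) ⟩
  ∣ F ∩ P zero ∣ + ∣ F ∩ ∁ (P zero) ∣
    ≡⟨ ∣p∩q∣+∣p∩∁q∣≡∣p∣ F (P zero) ⟩
  ∣ F ∣ ∎
  where
  open ≤-Reasoning
  disjoint-tail : PairwiseDisjoint (P ∘ suc)
  disjoint-tail i j i≢j = disjoint (suc i) (suc j) (i≢j ∘ suc-injective)

ZeroEmbedding : ∀ {m} → (Fin m → ℕ) → ℕ → Set
ZeroEmbedding {m} f L = Σ[ σ ∈ (Fin L → Fin m) ] Injective _≡_ _≡_ σ × (∀ j → f (σ j) ≡ 0)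

zeroEmbedding-suc : ∀ {m} {f : Fin (suc m) → ℕ} {L} → ZeroEmbedding (f ∘ suc) L → ZeroEmbedding f L
zeroEmbedding-suc (σ , σ-inj , σ-zero) = suc ∘ σ , σ-inj ∘ suc-injective , σ-zero

zeroEmbedding-zero : ∀ {m} {f : Fin (suc m) → ℕ} {L} → f zero ≡ 0 →
  ZeroEmbedding (f ∘ suc) L → ZeroEmbedding f (suc L)
zeroEmbedding-zero {f = f} f₀≡0 (σ , σ-inj , σ-zero) = zero ◂ suc ∘ σ , inj , zero-at
  where
  inj : Injective _≡_ _≡_ (zero ◂ suc ∘ σ)
  inj {zero}  {zero}  _ = refl
  inj {suc i} {suc j} e = cong suc (σ-inj (suc-injective e))
  zero-at : ∀ j → f ((zero ◂ suc ∘ σ) j) ≡ 0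
  zero-at zero    = f₀≡0
  zero-at (suc j) = σ-zero j

zeroEmbedding : ∀ m (f : Fin m → ℕ) L → L + sumFin m f ≤ m → ZeroEmbedding f L
zeroEmbedding m       f zero    _ = (λ ()) , (λ { {()} }) , (λ ())
zeroEmbedding (suc m) f (suc L) L+Σf≤m with f zero in f₀≡
... | zero  = zeroEmbedding-zero {f = f} f₀≡ (zeroEmbedding m (f ∘ suc) L (≤-pred L+Σf≤m))
... | suc a = zeroEmbedding-suc {f = f} (zeroEmbedding m (f ∘ suc) (suc L) (≤-trans L+Σf'≤L+Σf (≤-pred L+Σf≤m)))
  where
  Σf' = sumFin m (f ∘ suc)
  L+Σf'≤L+Σf : suc L + Σf' ≤ L + (suc a + Σf')
  L+Σf'≤L+Σf = ≤-trans (≤-reflexive (sym (+-suc L Σf'))) (+-monoʳ-≤ L (s≤s (m≤n+m Σf' a)))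

avoidingPetals : ∀ {n m} (P : Fin m → Subset n) → PairwiseDisjoint P → ∀ F L → L + ∣ F ∣ ≤ m →
  Σ[ σ ∈ (Fin L → Fin m) ] Injective _≡_ _≡_ σ × (∀ j → F ∩ P (σ j) ≡ ⊥)
avoidingPetals {m = m} P disjoint F L L+∣F∣≤m =
  let (σ , σ-inj , σ-zero) = zeroEmbedding m (λ i → ∣ F ∩ P i ∣) L
        (≤-trans (+-monoʳ-≤ L (sum-∣∩∣≤∣∣ m P disjoint F)) L+∣F∣≤m)
  in σ , σ-inj , ∣p∣≡0⇒p≡⊥ ∘ σ-zero

[t∪p]∩[t∪q]≡t : ∀ {n} (t : Subset n) {p q : Subset n} → p ∩ q ≡ ⊥ → (t ∪ p) ∩ (t ∪ q) ≡ t
[t∪p]∩[t∪q]≡t t {p} {q} p∩q≡⊥ = begin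
  (t ∪ p) ∩ (t ∪ q) ≡⟨ sym (∪-distribˡ-∩ t p q) ⟩
  t ∪ p ∩ q         ≡⟨ cong (t ∪_) p∩q≡⊥ ⟩
  t ∪ ⊥             ≡⟨ ∪-identityʳ t ⟩
  t                 ∎
  where open ≡-Reasoning

f∩[t∪p]≡f∩t : ∀ {n} (f t : Subset n) {p : Subset n} → f ∩ p ≡ ⊥ → f ∩ (t ∪ p) ≡ f ∩ t
f∩[t∪p]≡f∩t f t {p} f∩p≡⊥ = begin
  f ∩ (t ∪ p)       ≡⟨ ∩-distribˡ-∪ f t p ⟩
  f ∩ t ∪ f ∩ p     ≡⟨ cong (f ∩ t ∪_) f∩p≡⊥ ⟩
  f ∩ t ∪ ⊥         ≡⟨ ∪-identityʳ (f ∩ t) ⟩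
  f ∩ t             ∎
  where open ≡-Reasoning

uniform-distinct : ∀ {n k} {𝓕 : Family n} → Uniform k 𝓕 → ∀ {A B} → 𝓕 A → ∣ A ∩ B ∣ < k → A ≢ B
uniform-distinct uniform {A} A∈𝓕 ∣A∩B∣<k refl =
  <-irrefl (trans (cong ∣_∣ (∩-idem A)) (uniform A A∈𝓕)) ∣A∩B∣<k

distinct⇒injective : ∀ {m} {A : Set} (f : Fin m → A) → (∀ i j → i ≢ j → f i ≢ f j) → Injective _≡_ _≡_ f
distinct⇒injective f distinct {i} {j} fi≡fj with i ≟ᶠ j
... | yes i≡j = i≡j
... | no  i≢j = contradiction fi≡fj (distinct i j i≢j)

sumFin-const : ∀ m {f : Fin m → ℕ} {c} → (∀ i → f i ≡ c) → sumFin m f ≡ m * c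
sumFin-const zero    f≡c = refl
sumFin-const (suc m) f≡c = cong₂ _+_ (f≡c zero) (sumFin-const m (f≡c ∘ suc))

[1+m]C2≡m+mC2 : ∀ m → suc m C 2 ≡ m + m C 2
[1+m]C2≡m+mC2 m = trans (sym (nCk+nC[k+1]≡[n+1]C[k+1] m 1)) (cong (_+ m C 2) (nC1≡n m))

pairSum-const : ∀ m {f : Fin m → Fin m → ℕ} {c} → (∀ i j → i ≢ j → f i j ≡ c) → pairSum m f ≡ (m C 2) * c
pairSum-const zero    f≡c = refl
pairSum-const (suc m) {c = c} f≡c = begin
  sumFin m _ + pairSum m _ ≡⟨ cong₂ _+_ (sumFin-const m λ j → f≡c zero (suc j) λ ())
                                        (pairSum-const m λ i j i≢j → f≡c (suc i) (suc j) (i≢j ∘ suc-injective)) ⟩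
  m * c + (m C 2) * c      ≡⟨ sym (*-distribʳ-+ c m (m C 2)) ⟩
  (m + m C 2) * c          ≡⟨ cong (_* c) (sym ([1+m]C2≡m+mC2 m)) ⟩
  (suc m C 2) * c          ∎
  where open ≡-Reasoning

pairBound⇒≤ : ∀ L t x .{{_ : NonZero L}} → (suc L C 2) * t + L C 2 ≤ L * x + (L C 2) * suc t → t ≤ x
pairBound⇒≤ L t x bound = *-cancelˡ-≤ L (+-cancelʳ-≤ ((L C 2) * suc t) (L * t) (L * x) (begin
  L * t + (L C 2) * suc t  ≡⟨ sym (regroup L (L C 2) t) ⟩
  (L + L C 2) * t + L C 2  ≡⟨ cong (λ c → c * t + L C 2) (sym ([1+m]C2≡m+mC2 L)) ⟩
  (suc L C 2) * t + L C 2  ≤⟨ bound ⟩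
  L * x + (L C 2) * suc t  ∎))
  where
  open ≤-Reasoning
  regroup : ∀ a c t → (a + c) * t + c ≡ a * t + c * suc t
  regroup = solve-∀

nearlyContainsKernel : ∀ {n k m} L t .{{_ : NonZero L}} → suc t < k → L + k ≤ m →
  (𝓕 : Family n) → Uniform k 𝓕 →
  ((G : Fin (suc L) → Subset n) → Injective _≡_ _≡_ G → (∀ i → 𝓕 (G i)) →
    (suc L C 2) * t + L C 2 ≤ pairSum (suc L) (λ i j → ∣ G i ∩ G j ∣)) →
  (T : Subset n) → ∣ T ∣ ≡ suc t → (P : Fin m → Subset n) → IsSunflowerIn 𝓕 T m P →
  ∀ F → 𝓕 F → t ≤ ∣ F ∩ T ∣
nearlyContainsKernel {n} {k} {m} L t t<k L+k≤m 𝓕 uniform bound T ∣T∣≡ P (disjoint , _ , member∈𝓕) F F∈𝓕 =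
  pairBound⇒≤ L t ∣ F ∩ T ∣ (≤-trans (bound G G-injective G∈𝓕) (≤-reflexive pairSum-G))
  where
  avoiding : Σ[ σ ∈ (Fin L → Fin m) ] Injective _≡_ _≡_ σ × (∀ j → F ∩ P (σ j) ≡ ⊥)
  avoiding = avoidingPetals P disjoint F L (subst (λ s → L + s ≤ m) (sym (uniform F F∈𝓕)) L+k≤m)

  σ : Fin L → Fin m
  σ = proj₁ avoiding

  σ-injective : Injective _≡_ _≡_ σ
  σ-injective = proj₁ (proj₂ avoiding)

  members : Fin L → Subset n
  members j = T ∪ P (σ j)

  G : Fin (suc L) → Subset n
  G = F ◂ members

  G∈𝓕 : ∀ i → 𝓕 (G i)
  G∈𝓕 zero    = F∈𝓕
  G∈𝓕 (suc j) = member∈𝓕 (σ j)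

  ∣F∩member∣ : ∀ j → ∣ F ∩ members j ∣ ≡ ∣ F ∩ T ∣
  ∣F∩member∣ j = cong ∣_∣ (f∩[t∪p]≡f∩t F T (proj₂ (proj₂ avoiding) j))

  ∣member∩member∣ : ∀ i j → i ≢ j → ∣ members i ∩ members j ∣ ≡ suc t
  ∣member∩member∣ i j i≢j =
    trans (cong ∣_∣ ([t∪p]∩[t∪q]≡t T (disjoint (σ i) (σ j) (i≢j ∘ σ-injective)))) ∣T∣≡

  ∣G∩G∣<k : ∀ i j → i ≢ j → ∣ G i ∩ G j ∣ < k
  ∣G∩G∣<k zero    zero    i≢j = contradiction refl i≢j
  ∣G∩G∣<k zero    (suc j) _   =
    ≤-<-trans (subst₂ _≤_ (sym (∣F∩member∣ j)) ∣T∣≡ (∣p∩q∣≤∣q∣ F T)) t<k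
  ∣G∩G∣<k (suc i) zero    _   = subst (_< k) (cong ∣_∣ (∩-comm F (members i))) (∣G∩G∣<k zero (suc i) λ ())
  ∣G∩G∣<k (suc i) (suc j) i≢j = subst (_< k) (sym (∣member∩member∣ i j (i≢j ∘ cong suc))) t<k

  G-injective : Injective _≡_ _≡_ G
  G-injective = distinct⇒injective G λ i j i≢j → uniform-distinct uniform (G∈𝓕 i) (∣G∩G∣<k i j i≢j)

  pairSum-G : pairSum (suc L) (λ i j → ∣ G i ∩ G j ∣) ≡ L * ∣ F ∩ T ∣ + (L C 2) * suc t
  pairSum-G = cong₂ _+_ (sumFin-const L ∣F∩member∣) (pairSum-const L ∣member∩member∣)

m+[2+n]∸2≡m+n : ∀ m n → m + suc (suc n) ∸ 2 ≡ m + n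
m+[2+n]∸2≡m+n m n = +-∸-assoc m (s≤s (s≤s z≤n))

1+a+b≤2b+a : ∀ a {b} → 0 < b → suc a + b ≤ 2 * b + a
1+a+b≤2b+a a {b} 0<b = begin
  suc a + b    ≡⟨ +-comm (suc a) b ⟩
  b + suc a    ≤⟨ +-monoʳ-≤ b (+-monoˡ-≤ a 0<b) ⟩
  b + (b + a)  ≡⟨ sym (+-assoc b b a) ⟩
  b + b + a    ≡⟨ cong (λ c → b + c + a) (sym (+-identityʳ b)) ⟩
  2 * b + a    ∎
  where open ≤-Reasoning

lemma2 : (n t ℓ k : ℕ) → 1 ≤ t → 3 ≤ ℓ → t + ℓ ∸ 2 ≤ k →
    (𝓕 : Family n) → Uniform k 𝓕 →
    ((G : Fin ℓ → Subset n) → Injective _≡_ _≡_ G → (∀ i → 𝓕 (G i)) →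
      (ℓ C 2) * (t ∸ 1) + ((ℓ ∸ 1) C 2) ≤ pairSum ℓ (λ i j → ∣ G i ∩ G j ∣)) →
    (T : Subset n) → ∣ T ∣ ≡ t →
    (P : Fin (2 * k + ℓ ∸ 2) → Subset n) → IsSunflowerIn 𝓕 T (2 * k + ℓ ∸ 2) P →
    ∀ F → 𝓕 F → t ∸ 1 ≤ ∣ F ∩ T ∣
lemma2 n (suc t) (suc L@(suc (suc j))) k (s≤s z≤n) (s≤s (s≤s (s≤s z≤n))) t+ℓ∸2≤k =
  nearlyContainsKernel L t t<k L+k≤m
  where
  t<k : suc t < k
  t<k = <-≤-trans (m<m+n (suc t) (s≤s z≤n)) (subst (_≤ k) (m+[2+n]∸2≡m+n (suc t) (suc j)) t+ℓ∸2≤k)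
  L+k≤m : L + k ≤ 2 * k + suc L ∸ 2
  L+k≤m = subst (L + k ≤_) (sym (m+[2+n]∸2≡m+n (2 * k) (suc j)))
                (1+a+b≤2b+a (suc j) (≤-trans (s≤s z≤n) t<k))
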